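{- Let $c<1/2$ be a real number and let $D$ be an oriented graph on $l$ vertices with $\delta(D)\ge (1-2c)l$. Then for every positive integer $s\le l$, $D$ has at least $s$ vertices of out-degree at least $(l-s-2cl)/2$ and at least $s$ vertices of in-degree at least $(l-s-2cl)/2$. Moreover, there is a vertex $v$ of $D$ with $l/4-cl\le d^+(v)\le 3l/4+cl$.
   Context: An oriented graph is an orientation of a simple graph. For a vertex $v$, $d^+(v)$ and $d^-(v)$ are its out-degree and in-degree, its degree is $d_D(v)=d^+(v)+d^-(v)$, and $\delta(D)=\min_v d_D(v)$ is the minimum total degree.
   Formalization: The parameter c is a rational number instead of a real number. -}

module Defs where

open import Data.Nat using (ℕ; _+_)
open import Data.Bool using (Bool; true; false; if_then_else_)
open import Data.Fin using (Fin)
open import Data.List using (List; map; allFin)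
open import Data.Nat.ListAction using (sum)
open import Data.Integer using (+_)
open import Data.Rational using (ℚ; _/_)
open import Relation.Binary.PropositionalEquality using (_≡_)

record OrientedGraph (l : ℕ) : Set where
  field
    arc    : Fin l → Fin l → Bool
    irrefl : ∀ i → arc i i ≡ false
    asym   : ∀ i j → arc i j ≡ true → arc j i ≡ false

open OrientedGraph public

count : ∀ {l} → (Fin l → Bool) → ℕ
count {l} P = sum (map (λ j → if P j then 1 else 0) (allFin l))

outdeg : ∀ {l} → OrientedGraph l → Fin l → ℕ
outdeg D v = count (λ w → arc D v w)

indeg : ∀ {l} → OrientedGraph l → Fin l → ℕ
indeg D v = count (λ w → arc D w v)

deg : ∀ {l} → OrientedGraph l → Fin l → ℕ
deg D v = outdeg D v + indeg D v

toℚ : ℕ → ℚ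
toℚ n = + n / 1

{-# OPTIONS --safe #-}
-- Double counting the arcs inside a nonempty vertex set S yields v ∈ S whose
-- in-degree within S is at most its out-degree within S; since v has at most one
-- arc to each vertex outside S, d(v) + |S| ≤ 2d⁺(v) + l. If fewer than s vertices
-- had out-degree at least (l − s − 2cl)/2, the others would form such a set with
-- |S| > l − s, and its vertex v would have d⁺(v) ≥ (d(v) − s)/2 ≥ (l − s − 2cl)/2.
-- In-degrees are out-degrees of the reversed graph. For the last claim let H be the
-- set of vertices with d⁺ ≥ l/4 − cl. If |H| ≤ l/2, the bound for the complement of
-- H gives a vertex outside H with d⁺ ≥ d/2 − l/4 ≥ l/4 − cl, which is absurd.
-- Otherwise the bound for H in the reversed graph gives v ∈ H with
-- d⁻(v) ≥ d(v)/2 − l/4, so d⁺(v) ≤ d(v)/2 + l/4 ≤ 3l/4 + cl as (1 − 2c)l ≤ d(v) ≤ l.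
module Submission where

module Counting where
  open import Defs
  open import Data.Bool using (Bool; true; false; T; not; _∧_; if_then_else_)
  open import Data.Empty using (⊥-elim)
  open import Data.Fin using (Fin; zero; suc)
  open import Data.List using (tabulate)
  open import Data.List.Properties using (map-tabulate)
  import Data.Nat.ListAction as List
  open import Data.Nat using (ℕ; zero; suc; _+_; _*_; _≤_; _<_; z≤n; s≤s; s≤s⁻¹)
  open import Data.Nat.Properties
  open import Data.Product using (_×_; _,_; ∃-syntax)
  open import Data.Sum using (_⊎_; inj₁; inj₂)
  open import Data.Unit using (tt)
  open import Function using (id; _∘_)
  open import Relation.Binary.PropositionalEquality
    using (_≡_; refl; sym; trans; cong; cong₂; subst; module ≡-Reasoning)
  open import Relation.Nullary using (yes; no)

  open import Algebra.Properties.CommutativeMonoid.Sum +-0-commutativeMonoid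

  [_] : Bool → ℕ
  [ b ] = if b then 1 else 0

  sum-tabulate : ∀ {n} (f : Fin n → ℕ) → List.sum (tabulate f) ≡ ∑[ i < n ] f i
  sum-tabulate {zero}  f = refl
  sum-tabulate {suc n} f = cong (f zero +_) (sum-tabulate (f ∘ suc))

  count-as-∑ : ∀ {l} (P : Fin l → Bool) → count P ≡ ∑[ v < l ] [ P v ]
  count-as-∑ {l} P = trans (cong List.sum (map-tabulate id (λ v → [ P v ]))) (sum-tabulate (λ v → [ P v ]))

  ∑-one : ∀ n → ∑[ i < n ] 1 ≡ n
  ∑-one zero    = refl
  ∑-one (suc n) = cong suc (∑-one n)

  ∑-mono-≤ : ∀ {n} {f g : Fin n → ℕ} → (∀ i → f i ≤ g i) → ∑[ i < n ] f i ≤ ∑[ i < n ] g i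
  ∑-mono-≤ {zero}  f≤g = z≤n
  ∑-mono-≤ {suc n} f≤g = +-mono-≤ (f≤g zero) (∑-mono-≤ (f≤g ∘ suc))

  ∑-<⇒∃-< : ∀ {n} {f g : Fin n → ℕ} → ∑[ i < n ] f i < ∑[ i < n ] g i → ∃[ i ] (f i < g i)
  ∑-<⇒∃-< {suc n} {f} {g} ∑f<∑g with f zero <? g zero
  ... | yes f₀<g₀ = zero , f₀<g₀
  ... | no  f₀≮g₀ =
    let i , fᵢ<gᵢ = ∑-<⇒∃-< (+-cancelˡ-< (g zero) _ _ (≤-<-trans (+-monoˡ-≤ _ (≮⇒≥ f₀≮g₀)) ∑f<∑g))
    in suc i , fᵢ<gᵢ

  [a]+[b]≤1 : ∀ {a b} → (a ≡ true → b ≡ false) → [ a ] + [ b ] ≤ 1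
  [a]+[b]≤1 {false} {false} _ = z≤n
  [a]+[b]≤1 {false} {true}  _ = ≤-refl
  [a]+[b]≤1 {true}  {false} _ = ≤-refl
  [a]+[b]≤1 {true}  {true}  a⇒¬b with a⇒¬b refl
  ... | ()

  [a]+[b]+[s]≤[s∧a]+[s∧b]+1 : ∀ s {a b} → (a ≡ true → b ≡ false) →
    [ a ] + [ b ] + [ s ] ≤ [ s ∧ a ] + [ s ∧ b ] + 1
  [a]+[b]+[s]≤[s∧a]+[s∧b]+1 true  a⇒¬b = ≤-refl
  [a]+[b]+[s]≤[s∧a]+[s∧b]+1 false a⇒¬b = subst (_≤ 1) (sym (+-identityʳ _)) ([a]+[b]≤1 a⇒¬b)

  [s∧a]≤[a] : ∀ s a → [ s ∧ a ] ≤ [ a ]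
  [s∧a]≤[a] true  a = ≤-refl
  [s∧a]≤[a] false a = z≤n

  [b]+[not-b]≡1 : ∀ b → [ b ] + [ not b ] ≡ 1
  [b]+[not-b]≡1 true  = refl
  [b]+[not-b]≡1 false = refl

  count+count-not≡order : ∀ {l} (P : Fin l → Bool) → count P + count (not ∘ P) ≡ l
  count+count-not≡order {l} P = begin
    count P + count (not ∘ P)                 ≡⟨ cong₂ _+_ (count-as-∑ P) (count-as-∑ (not ∘ P)) ⟩
    ∑[ v < l ] [ P v ] + ∑[ v < l ] [ not (P v) ] ≡⟨ ∑-distrib-+ (λ v → [ P v ]) (λ v → [ not (P v) ]) ⟨
    ∑[ v < l ] ([ P v ] + [ not (P v) ])      ≡⟨ sum-cong-≗ ([b]+[not-b]≡1 ∘ P) ⟩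
    ∑[ v < l ] 1                              ≡⟨ ∑-one l ⟩
    l                                         ∎
    where open ≡-Reasoning

  2*m≤n⇒m<n : ∀ {m n} → 0 < n → 2 * m ≤ n → m < n
  2*m≤n⇒m<n {zero}  0<n _      = 0<n
  2*m≤n⇒m<n {suc m} _   2m≤n = <-≤-trans (m<m+n (suc m) (s≤s z≤n)) 2m≤n

  2*m≤m+n : ∀ {m n} → m ≤ n → 2 * m ≤ m + n
  2*m≤m+n {m} m≤n = +-monoʳ-≤ m (subst (_≤ _) (sym (+-identityʳ m)) m≤n)

  count-or-count-not-≤-half : ∀ {l} (P : Fin l → Bool) → 2 * count P ≤ l ⊎ 2 * count (not ∘ P) ≤ l
  count-or-count-not-≤-half P with ≤-total (count P) (count (not ∘ P))
  ... | inj₁ p≤q = inj₁ (≤-trans (2*m≤m+n p≤q) (≤-reflexive (count+count-not≡order P)))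
  ... | inj₂ q≤p = inj₂ (≤-trans (2*m≤m+n q≤p)
                          (≤-reflexive (trans (+-comm (count (not ∘ P)) (count P)) (count+count-not≡order P))))

  reverse : ∀ {l} → OrientedGraph l → OrientedGraph l
  reverse D = record
    { arc    = λ v u → arc D u v
    ; irrefl = irrefl D
    ; asym   = λ v u → asym D u v
    }

  deg-reverse : ∀ {l} (D : OrientedGraph l) v → deg (reverse D) v ≡ deg D v
  deg-reverse D v = +-comm (indeg D v) (outdeg D v)

  module _ {l} (D : OrientedGraph l) where

    outdegInto indegFrom : (Fin l → Bool) → Fin l → ℕ
    outdegInto S v = ∑[ u < l ] [ S u ∧ arc D v u ]
    indegFrom  S v = ∑[ u < l ] [ S u ∧ arc D u v ]

    deg-as-∑ : ∀ v → deg D v ≡ ∑[ u < l ] ([ arc D v u ] + [ arc D u v ])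
    deg-as-∑ v = begin
      outdeg D v + indeg D v                               ≡⟨ cong₂ _+_ (count-as-∑ (arc D v)) (count-as-∑ (λ u → arc D u v)) ⟩
      ∑[ u < l ] [ arc D v u ] + ∑[ u < l ] [ arc D u v ]  ≡⟨ ∑-distrib-+ (λ u → [ arc D v u ]) (λ u → [ arc D u v ]) ⟨
      ∑[ u < l ] ([ arc D v u ] + [ arc D u v ])           ∎
      where open ≡-Reasoning

    deg≤order : ∀ v → deg D v ≤ l
    deg≤order v = begin
      deg D v                                     ≡⟨ deg-as-∑ v ⟩
      ∑[ u < l ] ([ arc D v u ] + [ arc D u v ])  ≤⟨ ∑-mono-≤ (λ u → [a]+[b]≤1 (asym D v u)) ⟩
      ∑[ u < l ] 1                                ≡⟨ ∑-one l ⟩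
      l                                           ∎
      where open ≤-Reasoning

    deg+count≤outdegInto+indegFrom+order : ∀ S v → deg D v + count S ≤ outdegInto S v + indegFrom S v + l
    deg+count≤outdegInto+indegFrom+order S v = begin
      deg D v + count S
        ≡⟨ cong₂ _+_ (deg-as-∑ v) (count-as-∑ S) ⟩
      ∑[ u < l ] ([ arc D v u ] + [ arc D u v ]) + ∑[ u < l ] [ S u ]
        ≡⟨ ∑-distrib-+ (λ u → [ arc D v u ] + [ arc D u v ]) (λ u → [ S u ]) ⟨
      ∑[ u < l ] ([ arc D v u ] + [ arc D u v ] + [ S u ])
        ≤⟨ ∑-mono-≤ (λ u → [a]+[b]+[s]≤[s∧a]+[s∧b]+1 (S u) (asym D v u)) ⟩
      ∑[ u < l ] ([ S u ∧ arc D v u ] + [ S u ∧ arc D u v ] + 1)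
        ≡⟨ ∑-distrib-+ (λ u → [ S u ∧ arc D v u ] + [ S u ∧ arc D u v ]) (λ _ → 1) ⟩
      ∑[ u < l ] ([ S u ∧ arc D v u ] + [ S u ∧ arc D u v ]) + ∑[ u < l ] 1
        ≡⟨ cong₂ _+_ (∑-distrib-+ (λ u → [ S u ∧ arc D v u ]) (λ u → [ S u ∧ arc D u v ])) (∑-one l) ⟩
      outdegInto S v + indegFrom S v + l
        ∎
      where open ≤-Reasoning

    outdegInto≤outdeg : ∀ S v → outdegInto S v ≤ outdeg D v
    outdegInto≤outdeg S v = ≤-trans (∑-mono-≤ (λ u → [s∧a]≤[a] (S u) (arc D v u))) (≤-reflexive (sym (count-as-∑ (arc D v))))

    ∃-indegFrom≤outdegInto : ∀ S → 1 ≤ count S → ∃[ v ] (T (S v) × indegFrom S v ≤ outdegInto S v)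
    ∃-indegFrom≤outdegInto S 1≤|S| = let v , lt = ∑-<⇒∃-< ∑in<|S|+∑out in v , member v lt
      where
      arcWithin : Fin l → Fin l → Bool
      arcWithin v u = S v ∧ (S u ∧ arc D v u)

      -- Every arc inside S is counted once at each end.
      ∑in<|S|+∑out : ∑[ v < l ] ∑[ u < l ] [ arcWithin u v ] < ∑[ v < l ] ([ S v ] + ∑[ u < l ] [ arcWithin v u ])
      ∑in<|S|+∑out = begin-strict
        ∑[ v < l ] ∑[ u < l ] [ arcWithin u v ]
          ≡⟨ ∑-comm (λ v u → [ arcWithin u v ]) ⟩
        ∑[ v < l ] ∑[ u < l ] [ arcWithin v u ]
          <⟨ m<n+m _ (≤-trans 1≤|S| (≤-reflexive (count-as-∑ S))) ⟩
        ∑[ v < l ] [ S v ] + ∑[ v < l ] ∑[ u < l ] [ arcWithin v u ]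
          ≡⟨ ∑-distrib-+ (λ v → [ S v ]) (λ v → ∑[ u < l ] [ arcWithin v u ]) ⟨
        ∑[ v < l ] ([ S v ] + ∑[ u < l ] [ arcWithin v u ])
          ∎
        where open ≤-Reasoning

      member : ∀ v → ∑[ u < l ] [ arcWithin u v ] < [ S v ] + ∑[ u < l ] [ arcWithin v u ] →
        T (S v) × indegFrom S v ≤ outdegInto S v
      member v lt with S v
      ... | true  = tt , s≤s⁻¹ lt
      ... | false = ⊥-elim (n≮0 (≤-trans lt (≤-reflexive (sum-replicate-zero l))))

    ∃-deg+count≤2outdeg+order : ∀ S → 1 ≤ count S → ∃[ v ] (T (S v) × deg D v + count S ≤ 2 * outdeg D v + l)
    ∃-deg+count≤2outdeg+order S 1≤|S| =
      let v , Sv , in≤out = ∃-indegFrom≤outdegInto S 1≤|S|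
          out≤outdeg = outdegInto≤outdeg S v
      in v , Sv , (begin
        deg D v + count S                    ≤⟨ deg+count≤outdegInto+indegFrom+order S v ⟩
        outdegInto S v + indegFrom S v + l   ≤⟨ +-monoˡ-≤ l (+-mono-≤ out≤outdeg (≤-trans in≤out out≤outdeg)) ⟩
        outdeg D v + outdeg D v + l          ≡⟨ cong (λ n → outdeg D v + n + l) (+-identityʳ (outdeg D v)) ⟨
        2 * outdeg D v + l                   ∎)
      where open ≤-Reasoning

    ∃-deg≤2outdeg+count : ∀ P → count P < l → ∃[ v ] (T (not (P v)) × deg D v ≤ 2 * outdeg D v + count P)
    ∃-deg≤2outdeg+count P |P|<l =
      let v , ¬Pv , bound = ∃-deg+count≤2outdeg+order (not ∘ P) 1≤|¬P|
      in v , ¬Pv , +-cancelʳ-≤ (count (not ∘ P)) _ _ (begin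
        deg D v + count (not ∘ P)                     ≤⟨ bound ⟩
        2 * outdeg D v + l                            ≡⟨ cong (2 * outdeg D v +_) (count+count-not≡order P) ⟨
        2 * outdeg D v + (count P + count (not ∘ P))  ≡⟨ +-assoc (2 * outdeg D v) (count P) (count (not ∘ P)) ⟨
        2 * outdeg D v + count P + count (not ∘ P)    ∎)
      where
      open ≤-Reasoning
      1≤|¬P| : 1 ≤ count (not ∘ P)
      1≤|¬P| = +-cancelˡ-< (count P) 0 _ (begin-strict
        count P + 0                ≡⟨ +-identityʳ (count P) ⟩
        count P                    <⟨ |P|<l ⟩
        l                          ≡⟨ count+count-not≡order P ⟨
        count P + count (not ∘ P)  ∎)

module Arithmetic where
  open import Defs using (toℚ)
  import Data.Nat as ℕ
  import Data.Nat.Coprimality as Coprimality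
  open import Data.Integer using (+_)
  import Data.Integer as ℤ
  import Data.Integer.Properties as ℤ
  open import Data.Rational using (mkℚ; _/_; *≤*; 0ℚ; 1ℚ; ½; _+_; _*_; _-_; -_; _≤_)
  open import Data.Rational.Properties
  open import Data.Rational.Solver using (module +-*-Solver)
  open +-*-Solver using (solve; _:+_; _:*_; _:-_; con; _:=_)
  open import Relation.Binary.PropositionalEquality
    using (_≡_; refl; sym; trans; cong; cong₂; subst; subst₂; module ≡-Reasoning)

  toℚ≡mkℚ : ∀ n → toℚ n ≡ mkℚ (+ n) 0 (Coprimality.sym (Coprimality.1-coprimeTo n))
  toℚ≡mkℚ n = normalize-coprime (Coprimality.sym (Coprimality.1-coprimeTo n))

  toℚ-+ : ∀ m n → toℚ (m ℕ.+ n) ≡ toℚ m + toℚ n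
  toℚ-+ m n = begin
    + (m ℕ.+ n) / 1                            ≡⟨ cong (_/ 1) (cong₂ ℤ._+_ (ℤ.*-identityʳ (+ m)) (ℤ.*-identityʳ (+ n))) ⟨
    (+ m ℤ.* + 1 ℤ.+ + n ℤ.* + 1) / 1          ≡⟨ cong₂ _+_ (toℚ≡mkℚ m) (toℚ≡mkℚ n) ⟨
    toℚ m + toℚ n                              ∎
    where open ≡-Reasoning

  toℚ-* : ∀ m n → toℚ (m ℕ.* n) ≡ toℚ m * toℚ n
  toℚ-* m n = begin
    + (m ℕ.* n) / 1                            ≡⟨ cong (_/ 1) (ℤ.pos-* m n) ⟩
    (+ m ℤ.* + n) / 1                          ≡⟨ cong₂ _*_ (toℚ≡mkℚ m) (toℚ≡mkℚ n) ⟨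
    toℚ m * toℚ n                              ∎
    where open ≡-Reasoning

  toℚ-mono-≤ : ∀ {m n} → m ℕ.≤ n → toℚ m ≤ toℚ n
  toℚ-mono-≤ {m} {n} m≤n rewrite toℚ≡mkℚ m | toℚ≡mkℚ n =
    *≤* (subst₂ ℤ._≤_ (sym (ℤ.*-identityʳ (+ m))) (sym (ℤ.*-identityʳ (+ n))) (ℤ.+≤+ m≤n))

  ≤-from-difference : ∀ {p q r s} → p ≤ q → q - p ≡ s - r → r ≤ s
  ≤-from-difference {p} {q} {r} {s} p≤q q-p≡s-r = begin
    r           ≡⟨ +-identityˡ r ⟨
    0ℚ + r      ≤⟨ +-monoˡ-≤ r 0≤q-p ⟩
    q - p + r   ≡⟨ cong (_+ r) q-p≡s-r ⟩
    s - r + r   ≡⟨ solve 2 (λ r s → s :- r :+ r := s) refl r s ⟩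
    s           ∎
    where
    open ≤-Reasoning
    0≤q-p : 0ℚ ≤ q - p
    0≤q-p = subst (_≤ q - p) (+-inverseʳ p) (+-monoˡ-≤ (- p) p≤q)

  toℚ-2*+ : ∀ m n → toℚ (2 ℕ.* m ℕ.+ n) ≡ toℚ 2 * toℚ m + toℚ n
  toℚ-2*+ m n = trans (toℚ-+ (2 ℕ.* m) n) (cong (_+ toℚ n) (toℚ-* 2 m))

  -- In each bound below, the slack of the conclusion is a nonnegative combination
  -- (weights ½, ¼ and 1) of the slacks of the hypotheses.
  ½[l-s-2cl]≤o : ∀ c {d o m s l} → (1ℚ - toℚ 2 * c) * toℚ l ≤ toℚ d → d ℕ.≤ 2 ℕ.* o ℕ.+ m → m ℕ.≤ s →
    ½ * (toℚ l - toℚ s - toℚ 2 * c * toℚ l) ≤ toℚ o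
  ½[l-s-2cl]≤o c {d} {o} {m} {s} {l} h₁ h₂ h₃ =
    ≤-from-difference (*-monoˡ-≤-nonNeg ½ (+-mono-≤ (+-mono-≤ h₁ h₂ℚ) (toℚ-mono-≤ h₃)))
      (solve 6 (λ c d o m s l →
          con ½ :* (d :+ (con (toℚ 2) :* o :+ m) :+ s) :- con ½ :* ((con 1ℚ :- con (toℚ 2) :* c) :* l :+ d :+ m)
        := o :- con ½ :* (l :- s :- con (toℚ 2) :* c :* l))
        refl c (toℚ d) (toℚ o) (toℚ m) (toℚ s) (toℚ l))
    where
    h₂ℚ : toℚ d ≤ toℚ 2 * toℚ o + toℚ m
    h₂ℚ = subst (toℚ d ≤_) (toℚ-2*+ o m) (toℚ-mono-≤ h₂)

  l/4-cl≤o : ∀ c {d o m l} → (1ℚ - toℚ 2 * c) * toℚ l ≤ toℚ d → d ℕ.≤ 2 ℕ.* o ℕ.+ m → 2 ℕ.* m ℕ.≤ l →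
    toℚ l * ½ * ½ - c * toℚ l ≤ toℚ o
  l/4-cl≤o c {d} {o} {m} {l} h₁ h₂ h₃ =
    ≤-from-difference (+-mono-≤ (*-monoˡ-≤-nonNeg ½ (+-mono-≤ h₁ h₂ℚ)) (*-monoˡ-≤-nonNeg (½ * ½) h₃ℚ))
      (solve 5 (λ c d o m l →
          con ½ :* (d :+ (con (toℚ 2) :* o :+ m)) :+ con (½ * ½) :* l
            :- (con ½ :* ((con 1ℚ :- con (toℚ 2) :* c) :* l :+ d) :+ con (½ * ½) :* (con (toℚ 2) :* m))
        := o :- (l :* con ½ :* con ½ :- c :* l))
        refl c (toℚ d) (toℚ o) (toℚ m) (toℚ l))
    where
    h₂ℚ : toℚ d ≤ toℚ 2 * toℚ o + toℚ m
    h₂ℚ = subst (toℚ d ≤_) (toℚ-2*+ o m) (toℚ-mono-≤ h₂)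
    h₃ℚ : toℚ 2 * toℚ m ≤ toℚ l
    h₃ℚ = subst (_≤ toℚ l) (toℚ-* 2 m) (toℚ-mono-≤ h₃)

  o≤3l/4+cl : ∀ c {o i m l} → (1ℚ - toℚ 2 * c) * toℚ l ≤ toℚ (o ℕ.+ i) → i ℕ.+ o ℕ.≤ 2 ℕ.* i ℕ.+ m →
    2 ℕ.* m ℕ.≤ l → o ℕ.+ i ℕ.≤ l → toℚ o ≤ toℚ 3 * toℚ l * ½ * ½ + c * toℚ l
  o≤3l/4+cl c {o} {i} {m} {l} h₁ h₂ h₃ h₄ =
    ≤-from-difference
      (+-mono-≤ (+-mono-≤ (*-monoˡ-≤-nonNeg ½ (+-mono-≤ h₁ℚ h₂ℚ)) (*-monoˡ-≤-nonNeg (½ * ½) h₃ℚ)) h₄ℚ)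
      (solve 5 (λ c o i m l →
          con ½ :* ((o :+ i) :+ (con (toℚ 2) :* i :+ m)) :+ con (½ * ½) :* l :+ l
            :- (con ½ :* ((con 1ℚ :- con (toℚ 2) :* c) :* l :+ (i :+ o)) :+ con (½ * ½) :* (con (toℚ 2) :* m) :+ (o :+ i))
        := con (toℚ 3) :* l :* con ½ :* con ½ :+ c :* l :- o)
        refl c (toℚ o) (toℚ i) (toℚ m) (toℚ l))
    where
    h₁ℚ : (1ℚ - toℚ 2 * c) * toℚ l ≤ toℚ o + toℚ i
    h₁ℚ = subst (_ ≤_) (toℚ-+ o i) h₁
    h₂ℚ : toℚ i + toℚ o ≤ toℚ 2 * toℚ i + toℚ m
    h₂ℚ = subst₂ _≤_ (toℚ-+ i o) (toℚ-2*+ i m) (toℚ-mono-≤ h₂)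
    h₃ℚ : toℚ 2 * toℚ m ≤ toℚ l
    h₃ℚ = subst (_≤ toℚ l) (toℚ-* 2 m) (toℚ-mono-≤ h₃)
    h₄ℚ : toℚ o + toℚ i ≤ toℚ l
    h₄ℚ = subst (_≤ toℚ l) (toℚ-+ o i) (toℚ-mono-≤ h₄)

open import Defs
open import Data.Nat using (ℕ; _≤_)
open import Data.Product using (_×_; ∃-syntax)
open import Data.Rational using (ℚ; _-_; _+_; _*_; ½; 1ℚ) renaming (_≤_ to _≤ℚ_; _<_ to _<ℚ_)
open import Relation.Nullary.Decidable using (⌊_⌋)
open import Data.Rational.Properties using (_≤?_)

import Data.Nat as ℕ
open import Data.Nat.Properties using (≮⇒≥; <⇒≤; <-≤-trans)
open import Data.Bool using (T; not)
open import Data.Bool.Properties using (not-involutive)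
open import Data.Empty using (⊥-elim)
open import Data.Product using (_,_)
open import Data.Sum using ([_,_]′)
open import Function using (_∘_)
open import Relation.Binary.PropositionalEquality using (sym; subst)
open import Relation.Nullary using (Dec; ¬_)
open import Relation.Nullary.Decidable using (toWitness; toWitnessFalse)
open Counting
open Arithmetic

-- The decision procedures are parameters and the ℕ arguments of the arithmetic
-- lemmas are given explicitly: unifying through ℚ's _≤?_ or toℚ on open terms makes
-- Agda normalise rational arithmetic, which is prohibitively expensive.
module _ (c : ℚ) {l} (D : OrientedGraph l)
         (minDeg : ∀ v → (1ℚ - toℚ 2 * c) * toℚ l ≤ℚ toℚ (deg D v)) where

  many-large-outdeg : ∀ s → s ≤ l →
    (large? : ∀ v → Dec (½ * (toℚ l - toℚ s - toℚ 2 * c * toℚ l) ≤ℚ toℚ (outdeg D v))) →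
    s ≤ count (λ v → ⌊ large? v ⌋)
  many-large-outdeg s s≤l large? = ≮⇒≥ λ few →
    let v , small , bound = ∃-deg≤2outdeg+count D (λ v → ⌊ large? v ⌋) (<-≤-trans few s≤l)
    in toWitnessFalse {a? = large? v} small (½[l-s-2cl]≤o c {o = outdeg D v} {l = l} (minDeg v) bound (<⇒≤ few))

  ¬heavy-minority : 1 ≤ l → (heavy? : ∀ v → Dec (toℚ l * ½ * ½ - c * toℚ l ≤ℚ toℚ (outdeg D v))) →
    ¬ (2 ℕ.* count (λ v → ⌊ heavy? v ⌋) ≤ l)
  ¬heavy-minority 1≤l heavy? 2|heavy|≤l =
    let v , light , bound = ∃-deg≤2outdeg+count D (λ v → ⌊ heavy? v ⌋) (2*m≤n⇒m<n 1≤l 2|heavy|≤l)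
    in toWitnessFalse {a? = heavy? v} light (l/4-cl≤o c {o = outdeg D v} {l = l} (minDeg v) bound 2|heavy|≤l)

  light-minority⇒balanced : 1 ≤ l → (heavy? : ∀ v → Dec (toℚ l * ½ * ½ - c * toℚ l ≤ℚ toℚ (outdeg D v))) →
    2 ℕ.* count (λ v → not ⌊ heavy? v ⌋) ≤ l →
    ∃[ v ] ((toℚ l * ½ * ½ - c * toℚ l ≤ℚ toℚ (outdeg D v))
          × (toℚ (outdeg D v) ≤ℚ toℚ 3 * toℚ l * ½ * ½ + c * toℚ l))
  light-minority⇒balanced 1≤l heavy? 2|light|≤l =
    let v , heavy , bound = ∃-deg≤2outdeg+count (reverse D) (λ v → not ⌊ heavy? v ⌋) (2*m≤n⇒m<n 1≤l 2|light|≤l)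
    in v , toWitness {a? = heavy? v} (subst T (not-involutive ⌊ heavy? v ⌋) heavy) ,
       o≤3l/4+cl c {o = outdeg D v} {i = indeg D v} {l = l} (minDeg v) bound 2|light|≤l (deg≤order D v)

  balanced-vertex : 1 ≤ l →
    (heavy? : ∀ v → Dec (toℚ l * ½ * ½ - c * toℚ l ≤ℚ toℚ (outdeg D v))) →
    ∃[ v ] ((toℚ l * ½ * ½ - c * toℚ l ≤ℚ toℚ (outdeg D v))
          × (toℚ (outdeg D v) ≤ℚ toℚ 3 * toℚ l * ½ * ½ + c * toℚ l))
  balanced-vertex 1≤l heavy? =
    [ ⊥-elim ∘ ¬heavy-minority 1≤l heavy? , light-minority⇒balanced 1≤l heavy? ]′
      (count-or-count-not-≤-half (λ v → ⌊ heavy? v ⌋))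

lemma3p4 : (c : ℚ) → c <ℚ ½ → (l : ℕ) → 1 ≤ l → (D : OrientedGraph l) →
    (∀ v → (1ℚ - toℚ 2 * c) * toℚ l ≤ℚ toℚ (deg D v)) →
    ((s : ℕ) → 1 ≤ s → s ≤ l →
      (s ≤ count (λ v → ⌊ ½ * (toℚ l - toℚ s - toℚ 2 * c * toℚ l) ≤? toℚ (outdeg D v) ⌋))
      × (s ≤ count (λ v → ⌊ ½ * (toℚ l - toℚ s - toℚ 2 * c * toℚ l) ≤? toℚ (indeg D v) ⌋)))
    × (∃[ v ] ((toℚ l * ½ * ½ - c * toℚ l ≤ℚ toℚ (outdeg D v))
              × (toℚ (outdeg D v) ≤ℚ toℚ 3 * toℚ l * ½ * ½ + c * toℚ l)))
lemma3p4 c _ l 1≤l D minDeg =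
  (λ s _ s≤l → many-large-outdeg c D minDeg s s≤l (λ v → _ ≤? _)
             , many-large-outdeg c (reverse D) minDegʳ s s≤l (λ v → _ ≤? _)) ,
  balanced-vertex c D minDeg 1≤l (λ v → _ ≤? _)
  where
  minDegʳ : ∀ v → (1ℚ - toℚ 2 * c) * toℚ l ≤ℚ toℚ (deg (reverse D) v)
  minDegʳ v = subst (λ n → (1ℚ - toℚ 2 * c) * toℚ l ≤ℚ toℚ n) (sym (deg-reverse D v)) (minDeg v)
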